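{- Let $\Phi$ be a derivation of $\Gamma\vdash t:\tau$ in system $\mathcal{V}$, where $t$ is a pure $\lambda$-term. If $\Phi$ is normal, then $t$ is in weak-head normal form.
   Context: Pure $\lambda$-terms; occurrences are words over $\{0,1\}$ ($0$: function part of an application or abstraction body, $1$: argument); redex occurrences $p$ with $t|_p=(\lambda x.s)u$. Weak-head normal forms: $\lambda x.t$ or $x\,t_1\cdots t_n$ ($n\geq0$). System $\mathcal{V}$: types $\tau::=\mathtt{a}\mid\alpha\mid\mathcal{M}\to\tau$ ($\mathcal{M}$ finite multisets of types); contexts map variables to multisets (finite support), added pointwise by multiset union. Rules: (ax) $x:[\tau]\vdash x:\tau$; (val) $\emptyset\vdash\lambda x.t:\mathtt{a}$; ($\to$i) from $\Gamma\vdash t:\tau$ infer $\Gamma\setminus x\vdash\lambda x.t:\Gamma(x)\to\tau$; ($\to$e) from $\Gamma\vdash t:[\sigma_i]_{i\in I}\to\tau$ and $(\Delta_i\vdash u:\sigma_i)_{i\in I}$ infer $\Gamma+\sum_i\Delta_i\vdash t\,u:\tau$. Typed occurrences $\mathrm{toc}(\Phi)$: $\{\epsilon\}$ for (ax),(val); $\{\epsilon\}\cup0\cdot\mathrm{toc}(\Phi_t)$ for ($\to$i) with premise $\Phi_t$; $\{\epsilon\}\cup0\cdot\mathrm{toc}(\Phi_t)\cup\bigcup_i1\cdot\mathrm{toc}(\Phi_u^i)$ for ($\to$e) with premises $\Phi_t,(\Phi_u^i)_i$. $\Phi$ with subject $t$ is normal if no redex occurrence of $t$ belongs to $\mathrm{toc}(\Phi)$.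 -}

module Defs where

open import Data.Nat using (ℕ)
open import Data.Nat.Properties using (_≟_)
open import Data.List using (List; []; _∷_; _++_; [_])
open import Data.Product using (∃; ∃-syntax; _×_; _,_)
open import Relation.Nullary using (¬_; yes; no)
open import Relation.Binary.PropositionalEquality using (_≡_)

Var : Set
Var = ℕ

data Term : Set where
  var : Var → Term
  lam : Var → Term → Term
  app : Term → Term → Term

-- Occurrences: words over {0,1}; 0 = function part / abstraction body, 1 = argument.
data Dir : Set where
  d0 d1 : Dir

Pos : Set
Pos = List Dir

data RedexAt : Term → Pos → Set where
  here  : ∀ {x s u} → RedexAt (app (lam x s) u) []
  lamB  : ∀ {x t p} → RedexAt t p → RedexAt (lam x t) (d0 ∷ p)
  appF  : ∀ {t u p} → RedexAt t p → RedexAt (app t u) (d0 ∷ p)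
  appA  : ∀ {t u p} → RedexAt u p → RedexAt (app t u) (d1 ∷ p)

data Neutral : Term → Set where
  nvar : ∀ {x} → Neutral (var x)
  napp : ∀ {t u} → Neutral t → Neutral (app t u)

data WHNF : Term → Set where
  whnf-lam : ∀ {x t} → WHNF (lam x t)
  whnf-neu : ∀ {t} → Neutral t → WHNF t

-- Types of system V; multisets of types are represented by lists,
-- considered up to the multiset equivalence _≈ₘ_ below.
data Ty : Set where
  a   : Ty
  tv  : ℕ → Ty
  _⇒_ : List Ty → Ty → Ty

MSet : Set
MSet = List Ty

mutual
  data _≈_ : Ty → Ty → Set where
    ≈a   : a ≈ a
    ≈tv  : ∀ {n} → tv n ≈ tv n
    ≈⇒   : ∀ {M N τ τ'} → M ≈ₘ N → τ ≈ τ' → (M ⇒ τ) ≈ (N ⇒ τ')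

  data _≈ₘ_ : MSet → MSet → Set where
    []≈  : [] ≈ₘ []
    ∷≈   : ∀ {σ σ' M N₁ N₂} → σ ≈ σ' → M ≈ₘ (N₁ ++ N₂) → (σ ∷ M) ≈ₘ (N₁ ++ σ' ∷ N₂)

-- Contexts: variables to multisets (finite support automatic for derivable contexts).
Ctx : Set
Ctx = Var → MSet

∅ : Ctx
∅ _ = []

_⊕_ : Ctx → Ctx → Ctx
(Γ ⊕ Δ) y = Γ y ++ Δ y

single : Var → Ty → Ctx
single x τ y with y ≟ x
... | yes _ = [ τ ]
... | no  _ = []

_∖_ : Ctx → Var → Ctx
(Γ ∖ x) y with y ≟ x
... | yes _ = []
... | no  _ = Γ y

-- Derivations of system V.  Args Δ u L : a family (Δᵢ ⊢ u : σᵢ)_{i}, L = [σᵢ], Δ = Σ Δᵢ.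
mutual
  data _⊢_∶_ : Ctx → Term → Ty → Set where
    ax  : ∀ {x τ} → single x τ ⊢ var x ∶ τ
    val : ∀ {x t} → ∅ ⊢ lam x t ∶ a
    ⇒i  : ∀ {Γ x t τ} → Γ ⊢ t ∶ τ → (Γ ∖ x) ⊢ lam x t ∶ (Γ x ⇒ τ)
    ⇒e  : ∀ {Γ Δ t u M L τ} → Γ ⊢ t ∶ (M ⇒ τ) → M ≈ₘ L → Args Δ u L
        → (Γ ⊕ Δ) ⊢ app t u ∶ τ

  data Args : Ctx → Term → MSet → Set where
    []  : ∀ {u} → Args ∅ u []
    _∷_ : ∀ {Δ Δs u σ L} → Δ ⊢ u ∶ σ → Args Δs u L → Args (Δ ⊕ Δs) u (σ ∷ L)

mutual
  data _∈toc_ : ∀ {Γ t τ} → Pos → Γ ⊢ t ∶ τ → Set where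
    root : ∀ {Γ t τ} {Φ : Γ ⊢ t ∶ τ} → [] ∈toc Φ
    inI  : ∀ {Γ x t τ p} {Φ : Γ ⊢ t ∶ τ}
         → p ∈toc Φ → (d0 ∷ p) ∈toc (⇒i {x = x} Φ)
    inF  : ∀ {Γ Δ t u M L τ p} {Φ : Γ ⊢ t ∶ (M ⇒ τ)} {e : M ≈ₘ L} {Ψ : Args Δ u L}
         → p ∈toc Φ → (d0 ∷ p) ∈toc (⇒e Φ e Ψ)
    inA  : ∀ {Γ Δ t u M L τ p} {Φ : Γ ⊢ t ∶ (M ⇒ τ)} {e : M ≈ₘ L} {Ψ : Args Δ u L}
         → p ∈tocArgs Ψ → (d1 ∷ p) ∈toc (⇒e Φ e Ψ)

  data _∈tocArgs_ : ∀ {Δ u L} → Pos → Args Δ u L → Set where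
    hd : ∀ {Δ Δs u σ L p} {Φ : Δ ⊢ u ∶ σ} {Ψ : Args Δs u L}
       → p ∈toc Φ → p ∈tocArgs (Φ ∷ Ψ)
    tl : ∀ {Δ Δs u σ L p} {Φ : Δ ⊢ u ∶ σ} {Ψ : Args Δs u L}
       → p ∈tocArgs Ψ → p ∈tocArgs (Φ ∷ Ψ)

Normal : ∀ {Γ t τ} → Γ ⊢ t ∶ τ → Set
Normal {t = t} Φ = ∀ p → RedexAt t p → ¬ (p ∈toc Φ)

module Submission where

open import Defs
open import Data.List using (_∷_; [])
open import Data.Empty using (⊥-elim)

-- The function part t of a typed application t u is typed, so by induction it is
-- in weak-head normal form; it cannot be an abstraction, since then the root would
-- be a typed redex.

normal-⇒e-fun : ∀ {Γ Δ t u M L τ} {Φ : Γ ⊢ t ∶ (M ⇒ τ)} {e : M ≈ₘ L} {Ψ : Args Δ u L}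
              → Normal (⇒e Φ e Ψ) → Normal Φ
normal-⇒e-fun N p r p∈Φ = N (d0 ∷ p) (appF r) (inF p∈Φ)

mainTheorem14 : ∀ {Γ t τ} (Φ : Γ ⊢ t ∶ τ) → Normal Φ → WHNF t
mainTheorem14 ax N = whnf-neu nvar
mainTheorem14 val N = whnf-lam
mainTheorem14 (⇒i Φ) N = whnf-lam
mainTheorem14 (⇒e Φ e Ψ) N with mainTheorem14 Φ (normal-⇒e-fun N)
... | whnf-lam = ⊥-elim (N [] here root)
... | whnf-neu n = whnf-neu (napp n)
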